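{- Let $1<c_2<c_3$ be natural numbers, and let $\$_1=\langle 1,c_2,c_3,c_2+c_3-1\rangle$ and $\$_2=\langle 1,c_2,c_3,c_2+c_3-1,c_2+2c_3-2\rangle$ be coin systems such that $\$_2$ is canonical but $\$_1$ is not. Then the coin system $\$_3=\langle 1,c_2,c_3\rangle$ is canonical.
   Context: A coin system is a tuple $\langle c_1,\dots,c_m\rangle$ of natural numbers with $1=c_1<c_2<\cdots<c_m$. A representation of $x$ is a tuple $(\alpha_1,\dots,\alpha_m)$ of natural numbers with $\sum_i\alpha_ic_i=x$, of size $\sum_i\alpha_i$. The greedy representation $\mathrm{GRD}(x)$ is the representation with $\sum_{j<i}\alpha_jc_j<c_i$ for all $2\le i\le m$; $\mathrm{OPT}(x)$ is a representation of minimum size. The system is canonical if $|\mathrm{GRD}(x)|=|\mathrm{OPT}(x)|$ for all $x$, and non-canonical otherwise. -}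

module Defs where

open import Data.Nat using (ℕ; zero; suc; _+_; _*_; _∸_; _≤_; _<_)
open import Data.Fin using (Fin; toℕ; _<_)
open import Data.Vec using (Vec; lookup; []; _∷_)
open import Data.Product using (_×_)
open import Relation.Binary.PropositionalEquality using (_≡_)

record IsCoinSystem {m : ℕ} (c : Vec ℕ m) : Set where
  field
    first-one  : (i : Fin m) → toℕ i ≡ 0 → lookup c i ≡ 1
    increasing : (i j : Fin m) → i Data.Fin.< j → lookup c i Data.Nat.< lookup c j

dot : {m : ℕ} → Vec ℕ m → Vec ℕ m → ℕ
dot [] [] = 0
dot (a ∷ as) (c ∷ cs) = a * c + dot as cs

dotUpTo : {m : ℕ} → ℕ → Vec ℕ m → Vec ℕ m → ℕ
dotUpTo zero    _        _        = 0
dotUpTo (suc k) []       []       = 0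
dotUpTo (suc k) (a ∷ as) (c ∷ cs) = a * c + dotUpTo k as cs

size : {m : ℕ} → Vec ℕ m → ℕ
size [] = 0
size (a ∷ as) = a + size as

IsRep : {m : ℕ} → Vec ℕ m → ℕ → Vec ℕ m → Set
IsRep c x α = dot α c ≡ x

-- α is the greedy representation of x: a representation with
-- Σ_{j<i} α_j c_j < c_i for every i ≥ 2 (1-based), i.e. every 0-based index i ≥ 1.
IsGreedy : {m : ℕ} → Vec ℕ m → ℕ → Vec ℕ m → Set
IsGreedy c x α = IsRep c x α ×
  ((i : Fin _) → 1 ≤ toℕ i → dotUpTo (toℕ i) α c Data.Nat.< lookup c i)

Canonical : {m : ℕ} → Vec ℕ m → Set
Canonical {m} c = (x : ℕ) (g α : Vec ℕ m) → IsGreedy c x g → IsRep c x α → size g ≤ size α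

-- Over ⟨1, a⟩ the greedy representation of y is optimal, of size size₂ a y = y % a + y / a.
-- If adding b always increases size₂ a, then ⟨1, a, b⟩ is canonical: a representation using
-- k fewer coins b than the greedy one pays for k · b with coins 1 and a, which costs at least
-- k more coins.  Adding b = a + t increases size₂ a as soon as adding t never decreases it,
-- which holds for a = 2 and every t, and for t = a − 1.  When c₂ ≥ 3, canonicity of $₂ at
-- 2c₃ (greedy: c₂ + c₃ − 1 plus r = c₃ − c₂ + 1 in coins 1 and c₂; optimal: c₃ + c₃) forces
-- size₂ c₂ r ≤ 1, hence r = c₂, i.e. c₃ = 2c₂ − 1.
module Submission where

open import Defs
open import Data.Nat using (ℕ; zero; suc; _+_; _*_; _∸_; _<_; _≤_; z≤n; s≤s; z<s; NonZero)
open import Data.Nat.Properties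
open import Data.Nat.DivMod
open import Data.Nat.Divisibility using (n∣m*n)
open import Data.Nat.Tactic.RingSolver using (solve-∀)
open import Data.Fin using (Fin; zero; suc; toℕ)
open import Data.Vec using (Vec; []; _∷_; lookup)
open import Data.Product using (∃₂; _,_; _×_)
open import Data.Empty using (⊥-elim)
open import Relation.Nullary using (¬_)
open import Relation.Binary.PropositionalEquality

module _ (a : ℕ) .{{_ : NonZero a}} where

  size₂ : ℕ → ℕ
  size₂ y = y % a + y / a

  Increasing NonDecreasing : ℕ → Set
  Increasing    t = ∀ y → size₂ y < size₂ (y + t)
  NonDecreasing t = ∀ y → size₂ y ≤ size₂ (y + t)

  ∃digits : ∀ y → ∃₂ λ r q → r < a × y ≡ r + q * a
  ∃digits y = y % a , y / a , m%n<n y a , m≡m%n+[m/n]*n y a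

  size₂-digits : ∀ {r} q → r < a → size₂ (r + q * a) ≡ r + q
  size₂-digits {r} q r<a = cong₂ _+_ remainder quotient
    where
    open ≡-Reasoning
    remainder : (r + q * a) % a ≡ r
    remainder = trans ([m+kn]%n≡m%n r q a) (m<n⇒m%n≡m r<a)
    quotient : (r + q * a) / a ≡ q
    quotient = begin
      (r + q * a) / a    ≡⟨ +-distrib-/-∣ʳ r (n∣m*n q) ⟩
      r / a + q * a / a  ≡⟨ cong₂ _+_ (m<n⇒m/n≡0 r<a) (m*n/n≡m q a) ⟩
      q                  ∎

  size₂-minimal : ∀ u v → size₂ (u + v * a) ≤ u + v
  size₂-minimal u v with ∃digits u
  ... | r , q , r<a , refl = begin
    size₂ (r + q * a + v * a)  ≡⟨ cong size₂ (regroup r q v a) ⟩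
    size₂ (r + (q + v) * a)    ≡⟨ size₂-digits (q + v) r<a ⟩
    r + (q + v)                ≤⟨ +-monoʳ-≤ r (+-monoˡ-≤ v (m≤m*n q a)) ⟩
    r + (q * a + v)            ≡⟨ +-assoc r (q * a) v ⟨
    r + q * a + v              ∎
    where
    open ≤-Reasoning
    regroup : ∀ r q v a → r + q * a + v * a ≡ r + (q + v) * a
    regroup = solve-∀

  size₂-+a : ∀ y → size₂ (y + a) ≡ suc (size₂ y)
  size₂-+a y with ∃digits y
  ... | r , q , r<a , refl = begin
    size₂ (r + q * a + a)    ≡⟨ cong size₂ (regroup r q a) ⟩
    size₂ (r + suc q * a)    ≡⟨ size₂-digits (suc q) r<a ⟩
    r + suc q                ≡⟨ +-suc r q ⟩
    suc (r + q)              ≡⟨ cong suc (size₂-digits q r<a) ⟨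
    suc (size₂ (r + q * a))  ∎
    where
    open ≡-Reasoning
    regroup : ∀ r q a → r + q * a + a ≡ r + suc q * a
    regroup = solve-∀

  nonDecreasing⇒increasing : ∀ {t} → NonDecreasing t → Increasing (a + t)
  nonDecreasing⇒increasing {t} mono y = begin-strict
    size₂ y              ≤⟨ mono y ⟩
    size₂ (y + t)        <⟨ n<1+n _ ⟩
    suc (size₂ (y + t))  ≡⟨ size₂-+a (y + t) ⟨
    size₂ (y + t + a)    ≡⟨ cong size₂ (regroup y t a) ⟩
    size₂ (y + (a + t))  ∎
    where
    open ≤-Reasoning
    regroup : ∀ y t a → y + t + a ≡ y + (a + t)
    regroup = solve-∀

  size₂-≤1 : ∀ {y} → 2 ≤ y → size₂ y ≤ 1 → y ≡ a
  size₂-≤1 {y} 2≤y size≤1 with ∃digits y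
  ... | r , q , r<a , refl = digits q (subst (_≤ 1) (size₂-digits q r<a) size≤1) 2≤y
    where
    digits : ∀ {r} q → r + q ≤ 1 → 2 ≤ r + q * a → r + q * a ≡ a
    digits zero                 r≤1         2≤r = ⊥-elim (1+n≰n (≤-trans 2≤r r≤1))
    digits {zero}  (suc zero)    _           _   = +-identityʳ a
    digits {zero}  (suc (suc q)) (s≤s ())    _
    digits {suc r} (suc q)       (s≤s r+q≤0) _   = ⊥-elim (n≮0 (≤-trans (m≤n+m (suc q) r) r+q≤0))

nonDecreasing-pred : ∀ n → NonDecreasing (suc n) n
nonDecreasing-pred n y with ∃digits (suc n) y
... | zero , q , _ , refl = begin
  size₂ (suc n) (q * suc n)      ≡⟨ size₂-digits (suc n) q z<s ⟩
  q                              ≤⟨ m≤n+m q n ⟩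
  n + q                          ≡⟨ size₂-digits (suc n) q ≤-refl ⟨
  size₂ (suc n) (n + q * suc n)  ≡⟨ cong (size₂ (suc n)) (+-comm n (q * suc n)) ⟩
  size₂ (suc n) (q * suc n + n)  ∎
  where open ≤-Reasoning
... | suc r , q , r<a , refl = ≤-reflexive (begin
  size₂ (suc n) (suc r + q * suc n)      ≡⟨ size₂-digits (suc n) q r<a ⟩
  suc r + q                              ≡⟨ +-suc r q ⟨
  r + suc q                              ≡⟨ size₂-digits (suc n) (suc q) (<-trans (n<1+n r) r<a) ⟨
  size₂ (suc n) (r + suc q * suc n)      ≡⟨ cong (size₂ (suc n)) (regroup r q n) ⟩
  size₂ (suc n) (suc r + q * suc n + n)  ∎)
  where
  open ≡-Reasoning
  regroup : ∀ r q n → r + suc q * suc n ≡ suc r + q * suc n + n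
  regroup = solve-∀

nonDecreasing-2 : ∀ t → NonDecreasing 2 t
nonDecreasing-2 zero    y = ≤-reflexive (cong (size₂ 2) (sym (+-identityʳ y)))
nonDecreasing-2 (suc t) y = begin
  size₂ 2 y            ≤⟨ nonDecreasing-pred 1 y ⟩
  size₂ 2 (y + 1)      ≤⟨ nonDecreasing-2 t (y + 1) ⟩
  size₂ 2 (y + 1 + t)  ≡⟨ cong (size₂ 2) (+-assoc y 1 t) ⟩
  size₂ 2 (y + suc t)  ∎
  where open ≤-Reasoning

dot-1∷a : ∀ u v a → dot (u ∷ v ∷ []) (1 ∷ a ∷ []) ≡ u + v * a
dot-1∷a u v a = cong₂ _+_ (*-identityʳ u) (+-identityʳ (v * a))

quotient-maximal : ∀ {b u v w g} → w < b → u + v * b ≡ w + g * b → v ≤ g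
quotient-maximal {b} {u} {v} {w} {g} w<b eq = ≮⇒≥ λ g<v → <-irrefl refl (begin-strict
  suc g * b  ≤⟨ *-monoˡ-≤ b g<v ⟩
  v * b      ≤⟨ m≤n+m (v * b) u ⟩
  u + v * b  ≡⟨ eq ⟩
  w + g * b  <⟨ +-monoˡ-< (g * b) w<b ⟩
  b + g * b  ∎)
  where open ≤-Reasoning

module _ (a b : ℕ) .{{_ : NonZero a}} (increasing : Increasing a b) where

  size₂-+* : ∀ k y → size₂ a y + k ≤ size₂ a (y + k * b)
  size₂-+* zero    y = ≤-reflexive (trans (+-identityʳ _) (cong (size₂ a) (sym (+-identityʳ y))))
  size₂-+* (suc k) y = begin
    size₂ a y + suc k        ≡⟨ +-suc _ k ⟩
    suc (size₂ a y) + k      ≤⟨ +-monoˡ-≤ k (increasing y) ⟩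
    size₂ a (y + b) + k      ≤⟨ size₂-+* k (y + b) ⟩
    size₂ a (y + b + k * b)  ≡⟨ cong (size₂ a) (+-assoc y b (k * b)) ⟩
    size₂ a (y + suc k * b)  ∎
    where open ≤-Reasoning

  size₂-+*-minimal : ∀ {u v x w g} → w < b → u + v * a + x * b ≡ w + g * b →
                     size₂ a w + g ≤ u + v + x
  size₂-+*-minimal {u} {v} {x} {w} {g} w<b eq
    with m≤n⇒∃[o]m+o≡n (quotient-maximal {b} {u + v * a} {x} {w} {g} w<b eq)
  ... | k , refl = begin
    size₂ a w + (x + k)      ≡⟨ regroup (size₂ a w) x k ⟩
    size₂ a w + k + x        ≤⟨ +-monoˡ-≤ x (size₂-+* k w) ⟩
    size₂ a (w + k * b) + x  ≡⟨ cong (λ y → size₂ a y + x) small-coins ⟨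
    size₂ a (u + v * a) + x  ≤⟨ +-monoˡ-≤ x (size₂-minimal a u v) ⟩
    u + v + x                ∎
    where
    open ≤-Reasoning
    regroup : ∀ s x k → s + (x + k) ≡ s + k + x
    regroup = solve-∀
    split : ∀ w x k b → w + (x + k) * b ≡ w + k * b + x * b
    split = solve-∀
    small-coins : u + v * a ≡ w + k * b
    small-coins = +-cancelʳ-≡ (x * b) _ _ (trans eq (split w x k b))

  canonical-1∷a∷b : Canonical (1 ∷ a ∷ b ∷ [])
  canonical-1∷a∷b x (g₀ ∷ g₁ ∷ g₂ ∷ []) (α₀ ∷ α₁ ∷ α₂ ∷ []) (g-rep , g-greedy) α-rep = begin
    g₀ + (g₁ + (g₂ + 0))        ≡⟨ size₃ g₀ g₁ g₂ ⟩
    g₀ + g₁ + g₂                ≡⟨ cong (_+ g₂) (size₂-digits a g₁ g₀<a) ⟨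
    size₂ a (g₀ + g₁ * a) + g₂  ≤⟨ size₂-+*-minimal {α₀} {α₁} {α₂} w<b same-value ⟩
    α₀ + α₁ + α₂                ≡⟨ size₃ α₀ α₁ α₂ ⟨
    α₀ + (α₁ + (α₂ + 0))        ∎
    where
    open ≤-Reasoning
    size₃ : ∀ u v x → u + (v + (x + 0)) ≡ u + v + x
    size₃ = solve-∀
    dot₃ : ∀ u v x a b → u * 1 + (v * a + (x * b + 0)) ≡ u + v * a + x * b
    dot₃ = solve-∀
    g₀<a : g₀ < a
    g₀<a = subst (_< a) (trans (+-identityʳ _) (*-identityʳ g₀)) (g-greedy (suc zero) (s≤s z≤n))
    w<b : g₀ + g₁ * a < b
    w<b = subst (_< b) (dot-1∷a g₀ g₁ a) (g-greedy (suc (suc zero)) (s≤s z≤n))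
    same-value : α₀ + α₁ * a + α₂ * b ≡ g₀ + g₁ * a + g₂ * b
    same-value = begin-equality
      α₀ + α₁ * a + α₂ * b                      ≡⟨ dot₃ α₀ α₁ α₂ a b ⟨
      dot (α₀ ∷ α₁ ∷ α₂ ∷ []) (1 ∷ a ∷ b ∷ [])  ≡⟨ trans α-rep (sym g-rep) ⟩
      dot (g₀ ∷ g₁ ∷ g₂ ∷ []) (1 ∷ a ∷ b ∷ [])  ≡⟨ dot₃ g₀ g₁ g₂ a b ⟩
      g₀ + g₁ * a + g₂ * b                      ∎

module _ (p s : ℕ) where
  private
    a b r : ℕ
    a = 3 + p
    b = suc (a + s)
    r = suc (suc s)  -- 2 * b ∸ (a + b ∸ 1)

    coins greedy optimal : Vec ℕ 5
    coins   = 1 ∷ a ∷ b ∷ a + b ∸ 1 ∷ a + 2 * b ∸ 2 ∷ []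
    greedy  = r % a ∷ r / a ∷ 0 ∷ 1 ∷ 0 ∷ []
    optimal = 0 ∷ 0 ∷ 2 ∷ 0 ∷ 0 ∷ []

    digits : dot (r % a ∷ r / a ∷ []) (1 ∷ a ∷ []) ≡ r
    digits = trans (dot-1∷a (r % a) (r / a) a) (sym (m≡m%n+[m/n]*n r a))

    greedy-value : dot greedy coins ≡ dot optimal coins
    greedy-value = trans (regroup (r % a) (r / a) a c₄) (trans (cong (_+ c₄) digits) (sum p s))
      where
      c₄ : ℕ
      c₄ = 1 * (a + b ∸ 1) + 0
      regroup : ∀ u v a z → u * 1 + (v * a + z) ≡ u * 1 + (v * a + 0) + z
      regroup = solve-∀
      -- r + (a + b ∸ 1) ≡ 2 * b with the truncated subtractions evaluated, as the solver rejects ∸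
      sum : ∀ p s →
            suc (suc s) + (suc (suc (p + suc (3 + p + s))) + 0 + 0) ≡ 2 * suc (3 + p + s) + 0
      sum = solve-∀

    r<b : r < b
    r<b = s≤s (s≤s (s≤s (m≤n+m s (suc p))))

    greedy-isGreedy : IsGreedy coins (dot optimal coins) greedy
    greedy-isGreedy = greedy-value , bounds
      where
      bounds : (i : Fin 5) → 1 ≤ toℕ i → dotUpTo (toℕ i) greedy coins < lookup coins i
      bounds (suc zero) _ =
        subst (_< a) (sym (trans (+-identityʳ _) (*-identityʳ _))) (m%n<n r a)
      bounds (suc (suc zero)) _ =
        subst (_< b) (sym digits) r<b
      bounds (suc (suc (suc zero))) _ =
        subst (_< a + b ∸ 1) (sym digits) (<-≤-trans r<b (m≤n+m b (2 + p)))
      bounds (suc (suc (suc (suc zero)))) _ =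
        subst (_< a + 2 * b ∸ 2) (sym greedy-value)
              (s≤s (≤-trans (≤-reflexive (+-identityʳ (2 * b))) (m≤n+m (2 * b) p)))

  canonical⇒c₃≡2c₂-1 : Canonical (1 ∷ a ∷ b ∷ a + b ∸ 1 ∷ a + 2 * b ∸ 2 ∷ []) → b ≡ a + (2 + p)
  canonical⇒c₃≡2c₂-1 canonical = trans (sym (+-suc a s)) (cong (a +_) (suc-injective r≡a))
    where
    size-greedy : r % a + (r / a + 1) ≡ suc (size₂ a r)
    size-greedy = trans (sym (+-assoc (r % a) (r / a) 1)) (+-comm (size₂ a r) 1)
    r≡a : r ≡ a
    r≡a = size₂-≤1 a (s≤s (s≤s z≤n)) (≤-pred (subst (_≤ 2) size-greedy
      (canonical (dot optimal coins) greedy optimal greedy-isGreedy refl)))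

canonical-1∷2∷b : ∀ t → Canonical (1 ∷ 2 ∷ 2 + t ∷ [])
canonical-1∷2∷b t = canonical-1∷a∷b 2 (2 + t) (nonDecreasing⇒increasing 2 (nonDecreasing-2 t))

canonical-1∷a∷2a-1 : ∀ n → Canonical (1 ∷ suc n ∷ suc n + n ∷ [])
canonical-1∷a∷2a-1 n =
  canonical-1∷a∷b (suc n) (suc n + n) (nonDecreasing⇒increasing (suc n) (nonDecreasing-pred n))

lemma4 : (c₂ c₃ : ℕ) → 1 < c₂ → c₂ < c₃ →
    IsCoinSystem (1 ∷ c₂ ∷ c₃ ∷ (c₂ + c₃ ∸ 1) ∷ []) →
    IsCoinSystem (1 ∷ c₂ ∷ c₃ ∷ (c₂ + c₃ ∸ 1) ∷ (c₂ + 2 * c₃ ∸ 2) ∷ []) →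
    Canonical (1 ∷ c₂ ∷ c₃ ∷ (c₂ + c₃ ∸ 1) ∷ (c₂ + 2 * c₃ ∸ 2) ∷ []) →
    ¬ Canonical (1 ∷ c₂ ∷ c₃ ∷ (c₂ + c₃ ∸ 1) ∷ []) →
    Canonical (1 ∷ c₂ ∷ c₃ ∷ [])
lemma4 (suc zero) _ (s≤s ()) _ _ _ _ _
lemma4 (suc (suc zero)) _ _ c₂<c₃ _ _ _ _ with m≤n⇒∃[o]m+o≡n c₂<c₃
... | s , refl = canonical-1∷2∷b (suc s)
lemma4 (suc (suc (suc p))) _ _ c₂<c₃ _ _ canonical₂ _ with m≤n⇒∃[o]m+o≡n c₂<c₃
... | s , refl = subst (λ c₃ → Canonical (1 ∷ 3 + p ∷ c₃ ∷ []))
                       (sym (canonical⇒c₃≡2c₂-1 p s canonical₂)) (canonical-1∷a∷2a-1 (2 + p))
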